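{- Let $G$ be a connected graph and let $k$ be a positive integer. If $\operatorname{adim}_k(G)=t$ for some positive integer $t$, then there is an integer $k'\ge k$ for which $\operatorname{msad}_{k'}(G)\le t$.
   Context: All graphs are finite, simple and connected; $d_G(x,y)$ is the shortest-path distance. For an ordered set $S=\{s_1,\dots,s_l\}\subseteq V(G)$ and $x\in V(G)$, the metric representation is the vector $r(x|S)=(d_G(x,s_1),\dots,d_G(x,s_l))$, and the multiset representation is the multiset $m(x|S)=\{\!\{d_G(x,s_1),\dots,d_G(x,s_l)\}\!\}$. A nonempty set $S\subsetneq V(G)$ is a $k$-antiresolving set if $k$ is the largest integer such that every vertex $v\in V(G)\setminus S$ has at least $k$ vertices (counting $v$ itself) with the same metric representation as $v$ with respect to $S$; $\operatorname{adim}_k(G)$ (the $k$-metric antidimension) is the minimum cardinality of a $k$-antiresolving set. A nonempty set $S\subsetneq V(G)$ is a $k$-multiset antiresolving set ($k$-MARS) if $k$ is the largest integer such that for every $u\in V(G)\setminus S$ the set $\{v\in V(G): m(v|S)=m(u|S)\}$ has at least $k$ elements; equivalently, $k$ is the minimum size of an equivalence class of the relation "same multiset representation with respect to $S$" on $V(G)\setminus S$. $\operatorname{msad}_k(G)$ (the $k$-multiset antidimension) is the minimum cardinality of a $k$-MARS of $G$, with $\operatorname{msad}_k(G)=\infty$ if $G$ has no $k$-MARS. -}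

module Defs where

open import Data.Nat using (ℕ; zero; suc; _≤_)
open import Data.Bool using (Bool; true; false; _∨_; _∧_; if_then_else_)
open import Data.Fin using (Fin; _≟_)
open import Data.Fin.Subset using (Subset; inside; _∈_; _∉_; ∣_∣; Nonempty; ⊤)
open import Data.Vec using (lookup)
open import Data.List using (List; map; filterᵇ)
open import Data.Bool.ListAction using (any)
open import Data.List.Base using (allFin)
open import Data.List.Relation.Binary.Permutation.Propositional using (_↭_)
open import Data.Product using (Σ; ∃; _×_)
open import Relation.Binary.PropositionalEquality using (_≡_; _≢_)
open import Relation.Nullary using (¬_; does)
open import Function.Definitions using (Injective)

record Graph : Set where
  field
    n     : ℕ
    adj   : Fin n → Fin n → Bool
    sym   : ∀ x y → adj x y ≡ adj y x
    irrefl : ∀ x → adj x x ≡ false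

module _ (G : Graph) where
  open Graph G

  reach : ℕ → Fin n → Fin n → Bool
  reach zero    x y = does (x ≟ y)
  reach (suc m) x y = reach m x y ∨ any (λ z → reach m x z ∧ adj z y) (allFin n)

  Connected : Set
  Connected = ∀ x y → ∃ λ m → reach m x y ≡ true

  private
    search : ℕ → ℕ → Fin n → Fin n → ℕ
    search start zero    x y = start
    search start (suc b) x y = if reach start x y then start else search (suc start) b x y

  -- shortest-path distance d_G(x,y) (the least length of a walk from x to y;
  -- correct for connected graphs, since then d_G(x,y) ≤ n - 1)
  dist : Fin n → Fin n → ℕ
  dist x y = search 0 n x y

  -- the elements of S listed in increasing order (S viewed as an ordered set)
  elems : Subset n → List (Fin n)
  elems S = filterᵇ (λ x → does (lookup S x Data.Bool.≟ inside)) (allFin n)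

  r : Fin n → Subset n → List ℕ
  r x S = map (dist x) (elems S)

  -- multiset representation m(x|S); multiset equality is `_↭_` (permutation)
  mrep : Fin n → Subset n → List ℕ
  mrep x S = map (dist x) (elems S)

  -- u has at least k vertices (counting u) related to it by R
  AtLeast : (Fin n → Fin n → Set) → Fin n → ℕ → Set
  AtLeast R u k = Σ (Fin k → Fin n) λ f → Injective _≡_ _≡_ f × (∀ i → R (f i) u)

  SameMetric : Subset n → Fin n → Fin n → Set
  SameMetric S v u = r v S ≡ r u S

  SameMultiset : Subset n → Fin n → Fin n → Set
  SameMultiset S v u = mrep v S ↭ mrep u S

  Admissible : Subset n → Set
  Admissible S = Nonempty S × S ≢ ⊤

  IsAntiResolving : ℕ → Subset n → Set
  IsAntiResolving k S =
    Admissible S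
    × (∀ u → u ∉ S → AtLeast (SameMetric S) u k)
    × ¬ (∀ u → u ∉ S → AtLeast (SameMetric S) u (suc k))

  IsMARS : ℕ → Subset n → Set
  IsMARS k S =
    Admissible S
    × (∀ u → u ∉ S → AtLeast (SameMultiset S) u k)
    × ¬ (∀ u → u ∉ S → AtLeast (SameMultiset S) u (suc k))

  AdimEq : ℕ → ℕ → Set
  AdimEq k t =
    (∃ λ S → IsAntiResolving k S × ∣ S ∣ ≡ t)
    × (∀ S → IsAntiResolving k S → t ≤ ∣ S ∣)

  -- msad_k(G) ≤ t (msad_k(G) = ∞ when no k-MARS exists, then this fails)
  MsadLe : ℕ → ℕ → Set
  MsadLe k t = ∃ λ S → IsMARS k S × ∣ S ∣ ≤ t

{-# OPTIONS --safe #-}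
-- Let S be a k-antiresolving set with |S| = t. Vertices with the same metric
-- representation have the same multiset representation, so every multiset class
-- of a vertex outside S has at least k elements. The least size k′ of such a
-- class is therefore ≥ k, and S is a k′-MARS by the very definition of k′.
module Submission where

open import Defs
open import Data.Nat using (ℕ; suc; _≤_; _≥_; _>_; _≤?_)
import Data.Nat.Properties as ℕ
open import Data.Product using (∃; _×_; _,_; Σ; proj₁; proj₂; map₂)
open import Data.List using (List; length; filter; lookup; allFin)
open import Data.List.Properties using (≡-dec)
open import Data.List.Extrema ℕ.≤-totalOrder using (argmin; argmin-all; f[argmin]≤f[xs])
open import Data.List.Sort ℕ.≤-decTotalOrder using (sort; sort-↭; sort-↗)
open import Data.List.Relation.Unary.Sorted.TotalOrder.Properties using (↗↭↗⇒≋)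
open import Data.List.Relation.Binary.Pointwise using (Pointwise-≡⇒≡)
open import Data.List.Relation.Binary.Permutation.Propositional
  using (_↭_; ↭-sym; ↭-trans; ↭-reflexive; ↭⇒↭ₛ)
open import Data.List.Membership.Propositional using () renaming (_∈_ to _∈ₗ_)
open import Data.List.Membership.Propositional.Properties
  using (∈-lookup; ∈-filter⁺; ∈-filter⁻; ∈-allFin)
open import Data.List.Relation.Unary.Any using (index)
open import Data.List.Relation.Unary.Any.Properties using (lookup-index)
open import Data.List.Relation.Unary.All as All using ()
open import Data.List.Relation.Unary.All.Properties using (all-filter)
open import Data.List.Relation.Unary.AllPairs using (_∷_)
open import Data.List.Relation.Unary.Unique.Propositional using (Unique)
open import Data.List.Relation.Unary.Unique.Propositional.Properties using (allFin⁺; filter⁺)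
open import Data.Fin using (Fin; zero; suc; inject≤)
open import Data.Fin.Properties using (injective⇒≤; inject≤-injective; ¬∀⟶∃¬)
open import Data.Fin.Subset using (Subset; ⊤; _∈_; _∉_)
open import Data.Fin.Subset.Properties using (_∈?_; ∈⊤; ⊆-antisym)
open import Function using (_∘_)
open import Function.Definitions using (Injective)
open import Relation.Nullary using (¬_; Dec; yes; no; ¬?; contradiction; map′)
open import Relation.Unary using (Decidable)
open import Relation.Binary.PropositionalEquality using (_≡_; _≢_; refl; sym; cong; module ≡-Reasoning)

↭-dec : (xs ys : List ℕ) → Dec (xs ↭ ys)
↭-dec xs ys = map′ sorted≡⇒↭ ↭⇒sorted≡ (≡-dec ℕ._≟_ (sort xs) (sort ys))
  where
  sorted≡⇒↭ : sort xs ≡ sort ys → xs ↭ ys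
  sorted≡⇒↭ eq = ↭-trans (↭-sym (sort-↭ xs)) (↭-trans (↭-reflexive eq) (sort-↭ ys))
  ↭⇒sorted≡ : xs ↭ ys → sort xs ≡ sort ys
  ↭⇒sorted≡ p = Pointwise-≡⇒≡ (↗↭↗⇒≋ ℕ.≤-totalOrder (sort-↗ xs) (sort-↗ ys)
    (↭⇒↭ₛ (↭-trans (sort-↭ xs) (↭-trans p (↭-sym (sort-↭ ys))))))

Unique⇒lookup-injective : ∀ {A : Set} {xs : List A} → Unique xs →
  ∀ i j → lookup xs i ≡ lookup xs j → i ≡ j
Unique⇒lookup-injective (_ ∷ _) zero zero _ = refl
Unique⇒lookup-injective (x∉ ∷ _) zero (suc j) eq = contradiction eq (All.lookup x∉ (∈-lookup j))
Unique⇒lookup-injective (x∉ ∷ _) (suc i) zero eq = contradiction (sym eq) (All.lookup x∉ (∈-lookup i))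
Unique⇒lookup-injective (_ ∷ u) (suc i) (suc j) eq = cong suc (Unique⇒lookup-injective u i j eq)

≢⊤⇒∃∉ : ∀ {n} {S : Subset n} → S ≢ ⊤ → ∃ λ u → u ∉ S
≢⊤⇒∃∉ {n} {S} S≢⊤ =
  ¬∀⟶∃¬ n (_∈ S) (_∈? S) λ all∈ → S≢⊤ (⊆-antisym (λ _ → ∈⊤) (λ {x} _ → all∈ x))

∃-argmin : ∀ {n} {P : Fin n → Set} → Decidable P → (c : Fin n → ℕ) → ∃ P →
  ∃ λ u → P u × (∀ v → P v → c u ≤ c v)
∃-argmin {n} P? c (u₀ , Pu₀) =
  u , argmin-all c Pu₀ (all-filter P? (allFin n))
    , λ v Pv → All.lookup (f[argmin]≤f[xs] u₀ xs) (∈-filter⁺ P? (∈-allFin v) Pv)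
  where
  xs : List (Fin n)
  xs = filter P? (allFin n)
  u : Fin n
  u = argmin c u₀ xs

-- `AtLeast G R u k` unfolds to `HasDistinct (λ v → R v u) k`.
HasDistinct : ∀ {n} → (Fin n → Set) → ℕ → Set
HasDistinct {n} Q k = Σ (Fin k → Fin n) λ f → Injective _≡_ _≡_ f × (∀ i → Q (f i))

HasDistinct-map : ∀ {n} {Q Q′ : Fin n → Set} {k} → (∀ {v} → Q v → Q′ v) →
  HasDistinct Q k → HasDistinct Q′ k
HasDistinct-map Q⇒Q′ = map₂ (map₂ (Q⇒Q′ ∘_))

HasDistinct-antimono : ∀ {n} {Q : Fin n → Set} {m k} → m ≤ k →
  HasDistinct Q k → HasDistinct Q m
HasDistinct-antimono m≤k (f , f-inj , Qf) =
  (λ i → f (inject≤ i m≤k)) , (λ eq → inject≤-injective m≤k m≤k _ _ (f-inj eq)) , λ i → Qf _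

module _ {n} {Q : Fin n → Set} (Q? : Decidable Q) where
  private
    witnesses : List (Fin n)
    witnesses = filter Q? (allFin n)

  count : ℕ
  count = length witnesses

  hasDistinct-count : HasDistinct Q count
  hasDistinct-count =
    lookup witnesses
    , (λ {i} {j} → Unique⇒lookup-injective (filter⁺ Q? (allFin⁺ n)) i j)
    , λ i → proj₂ (∈-filter⁻ Q? {xs = allFin n} (∈-lookup i))

  hasDistinct⇒≤count : ∀ {m} → HasDistinct Q m → m ≤ count
  hasDistinct⇒≤count (f , f-inj , Qf) = injective⇒≤ index-injective
    where
    f∈ : ∀ i → f i ∈ₗ witnesses
    f∈ i = ∈-filter⁺ Q? (∈-allFin (f i)) (Qf i)
    index-injective : Injective _≡_ _≡_ (λ i → index (f∈ i))
    index-injective {i} {j} eq = f-inj (begin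
      f i                             ≡⟨ lookup-index (f∈ i) ⟩
      lookup witnesses (index (f∈ i)) ≡⟨ cong (lookup witnesses) eq ⟩
      lookup witnesses (index (f∈ j)) ≡⟨ lookup-index (f∈ j) ⟨
      f j                             ∎)
      where open ≡-Reasoning

module _ {n} (R : Fin n → Fin n → Set) (P : Fin n → Set) where

  -- For R = SameMultiset G S and P = (_∉ S), the last two conjuncts of
  -- `IsMARS G k S` are `ClassesAtLeast k` and `¬ ClassesAtLeast (suc k)`.
  ClassesAtLeast : ℕ → Set
  ClassesAtLeast k = ∀ u → P u → HasDistinct (λ v → R v u) k

  classesAtLeast-maximal : ∀ {k k′} → ClassesAtLeast k → ¬ ClassesAtLeast (suc k′) → k ≤ k′
  classesAtLeast-maximal {k} {k′} atLeast-k notAtLeast-1+k′ with k ≤? k′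
  ... | yes k≤k′ = k≤k′
  ... | no  k≰k′ = contradiction
    (λ u Pu → HasDistinct-antimono {Q = λ v → R v u} (ℕ.≰⇒> k≰k′) (atLeast-k u Pu))
    notAtLeast-1+k′

  ∃-minimalClassSize : (∀ u v → Dec (R v u)) → Decidable P → ∃ P →
    ∃ λ k → ClassesAtLeast k × ¬ ClassesAtLeast (suc k)
  ∃-minimalClassSize R? P? ∃P with ∃-argmin P? (λ u → count (R? u)) ∃P
  ... | u , Pu , minimal =
    count (R? u)
    , (λ v Pv → HasDistinct-antimono {Q = λ w → R w v} (minimal v Pv)
                  (hasDistinct-count (R? v)))
    , λ atLeast → ℕ.1+n≰n (hasDistinct⇒≤count (R? u) (atLeast u Pu))

module _ (G : Graph) where

  admissible⇒∃MARS : ∀ {S} → Admissible G S → ∃ λ k′ → IsMARS G k′ S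
  admissible⇒∃MARS {S} adm@(_ , S≢⊤) =
    map₂ (adm ,_) (∃-minimalClassSize (SameMultiset G S) (_∉ S)
      (λ u v → ↭-dec (mrep G v S) (mrep G u S)) (λ u → ¬? (u ∈? S)) (≢⊤⇒∃∉ S≢⊤))

  sameMetric⇒sameMultiset : ∀ {S v u} → SameMetric G S v u → SameMultiset G S v u
  sameMetric⇒sameMultiset = ↭-reflexive

corollary4 : (G : Graph) → Connected G → (k t : ℕ) → k > 0 → t > 0 →
    AdimEq G k t → ∃ λ k′ → k′ ≥ k × MsadLe G k′ t
corollary4 G _ k t _ _ ((S , (adm , metricClasses , _) , ∣S∣≡t) , _) =
  k′ , k≤k′ , S , mars , ℕ.≤-reflexive ∣S∣≡t
  where
  k′ : ℕ
  k′ = proj₁ (admissible⇒∃MARS G adm)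
  mars : IsMARS G k′ S
  mars = proj₂ (admissible⇒∃MARS G adm)
  multisetClasses : ClassesAtLeast (SameMultiset G S) (_∉ S) k
  multisetClasses u u∉S =
    HasDistinct-map {Q = λ v → SameMetric G S v u} {Q′ = λ v → SameMultiset G S v u}
      (sameMetric⇒sameMultiset G {S}) (metricClasses u u∉S)
  k≤k′ : k ≤ k′
  k≤k′ = classesAtLeast-maximal (SameMultiset G S) (_∉ S) multisetClasses (proj₂ (proj₂ mars))
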